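{- Let $k\ge 2$ and $n\ge 1$. For every traversal string $t=t_1\cdots t_n$ of length $n$, the smallest and the largest chips that can be on the vertex $v_t$ of layer $n+1$ in a stable configuration are \[\prod_{j=1}^n t_j\qquad\text{and}\qquad k^n+1-\prod_{j=1}^n (k+1-t_j),\] respectively.
   Context: The infinite rooted directed $k$-ary tree: every vertex has exactly $k$ children, ordered from leftmost (1st) to rightmost ($k$th), edges directed from parent to child. The root is on layer 1; children of a vertex on layer $\ell$ are on layer $\ell+1$. A traversal string $t=t_1\cdots t_i$ ($t_\ell\in\{1,\dots,k\}$) determines the vertex $v_t$ reached from the root by moving, at step $\ell$, to the $t_\ell$-th leftmost child; $v_t$ is on layer $i+1$. Labeled chip-firing: initially chips labeled $1,\dots,k^n$ are on the root. A vertex holding at least $k$ chips may fire: choose any $k$ of its chips and send the one with the $r$-th smallest label to the $r$-th leftmost child ($r=1,\dots,k$). The game ends when no vertex can fire (stable configuration); the choices made form a firing strategy. In every stable configuration each vertex of layer $n+1$ holds exactly one chip and no other vertex holds chips. -}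

module Defs where

open import Data.Nat using (ℕ; suc; _<_; _^_; _∸_; _+_)
open import Data.Fin as Fin using (Fin; toℕ)
open import Data.List using (List; []; _∷_; _++_; [_]; map; tabulate; upTo; length)
open import Data.Nat.ListAction using (product)
open import Data.List.Relation.Binary.Permutation.Propositional using (_↭_)
open import Data.List.Membership.Propositional using (_∈_)
open import Data.Product using (Σ; _×_; ∃)
open import Relation.Binary.PropositionalEquality using (_≡_; _≢_)
open import Relation.Binary.Construct.Closure.ReflexiveTransitive using (Star)

-- A vertex of the infinite k-ary tree is identified with its traversal string
-- from the root: a list of child indices (Fin k; index i means the (toℕ i + 1)-th
-- leftmost child).  The child r of vertex v is  v ++ [ r ].
Vertex : ℕ → Set
Vertex k = List (Fin k)

-- A (labeled) configuration: the chips (labels) held by each vertex, as a list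
-- understood up to permutation (a multiset).
Config : ℕ → Set
Config k = Vertex k → List ℕ

initial : (k n : ℕ) → Config k
initial k n [] = map suc (upTo (k ^ n))
initial k n (_ ∷ _) = []

data Fire {k : ℕ} (c c' : Config k) : Set where
  fire : (v : Vertex k) (s : Fin k → ℕ) (rest : List ℕ) →
         (∀ i j → i Fin.< j → s i < s j) →
         c v ↭ (tabulate s ++ rest) →
         c' v ≡ rest →
         (∀ r → c' (v ++ [ r ]) ↭ (s r ∷ c (v ++ [ r ]))) →
         (∀ w → w ≢ v → (∀ r → w ≢ v ++ [ r ]) → c' w ≡ c w) →
         Fire c c'

Reachable : (k n : ℕ) → Config k → Set
Reachable k n c = Star Fire (initial k n) c

Stable : {k : ℕ} → Config k → Set
Stable {k} c = ∀ v → length (c v) < k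

CanBeOn : (k n : ℕ) → Vertex k → ℕ → Set
CanBeOn k n v x = Σ (Config k) λ c → Reachable k n c × Stable c × x ∈ c v

-- ∏_j t_j  and  k^n + 1 − ∏_j (k + 1 − t_j), where letter i : Fin k stands for t_j = toℕ i + 1.
minChip : (k : ℕ) → List (Fin k) → ℕ
minChip k t = product (map (λ i → suc (toℕ i)) t)

maxChip : (k n : ℕ) → List (Fin k) → ℕ
maxChip k n t = k ^ n + 1 ∸ product (map (λ i → k ∸ toℕ i) t)

IsMinimum : (P : ℕ → Set) → ℕ → Set
IsMinimum P m = P m × (∀ x → P x → m Data.Nat.≤ x)

IsMaximum : (P : ℕ → Set) → ℕ → Set
IsMaximum P m = P m × (∀ x → P x → x Data.Nat.≤ m)

{-# OPTIONS --safe #-}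
module Submission where

-- Record, for every vertex, the batches it has fired so far.  The chips that ever
-- reached the child v·r are then exactly the r-th entries of the batches fired at v, and an
-- increasing batch whose r-th entry is at most x contains at least r chips at most x (letters
-- counted from 1).  So the number of chips ≤ x that ever reached a vertex drops by a factor of
-- at least t_j along the j-th edge of the path t; as at most x chips are ≤ x, t_1 ⋯ t_n ≤ x for
-- every chip x that reaches v_t.  Symmetrically, an increasing batch whose r-th entry is ≥ x
-- has at least k + 1 − r chips ≥ x, and at most k^n + 1 − x chips are ≥ x.
--
-- A vertex holding the chips of ranks 0, …, kN − 1 (N = k^(n−1)) fires N batches
-- whose first p slots take the Np lowest ranks and whose other slots take the rest; every child
-- then holds N chips and the construction recurses into each child in turn.  With p = t_1 the
-- target child receives the ranks j·t_1 + t_1 − 1, so the chip finally reaching v_t has rank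
-- t_1 ⋯ t_n − 1; with p = t_1 − 1 it receives the ranks N(t_1 − 1) + j(k + 1 − t_1), and the
-- final rank is k^n − ∏ (k + 1 − t_j).  (The chip of rank i is labelled i + 1.)

open import Defs
open import Algebra.Bundles using (CommutativeMonoid)
import Algebra.Properties.CommutativeSemigroup
open import Data.Fin as Fin using (Fin; toℕ)
open import Data.Fin.Properties using (toℕ<n)
open import Data.List
  using (List; []; _∷_; _++_; [_]; map; tabulate; length; filter; concat; concatMap; upTo; applyUpTo; allFin)
open import Data.List.Properties
  using ( ≡-dec; ∷-injectiveˡ; ∷-injectiveʳ; ∷ʳ-injectiveˡ; ++-assoc; ++-identityʳ; ++-cancelˡ
        ; ++-identityʳ-unique; map-++; map-∘; map-upTo; concat-map; concatMap-cong; length-++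
        ; length-tabulate; length-filter; filter-++; filter-all; filter-accept; filter-reject )
open import Data.List.Membership.Propositional using (_∈_)
open import Data.List.Membership.Propositional.Properties using (∈-filter⁺; ∈-length; ∈-++⁺ˡ; ∈-allFin)
open import Data.List.Relation.Binary.Permutation.Propositional
  using (_↭_; prep; ↭-refl; ↭-trans; ↭-reflexive; module PermutationReasoning)
open import Data.List.Relation.Binary.Permutation.Propositional.Properties
  using ( ↭-length; ↭-empty-inv; ↭-singleton-inv; ++⁺ˡ; ++⁺ʳ; shift; shifts; map⁺; filter-↭
        ; ++-commutativeMonoid )
open import Data.List.Relation.Unary.All as All using (All; []; _∷_)
open import Data.List.Relation.Unary.All.Properties using (tabulate⁺; gmap⁺)
open import Data.List.Relation.Unary.Any using (here)
open import Data.List.Relation.Unary.Unique.Propositional using (Unique; []; _∷_)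
open import Data.List.Relation.Unary.Unique.Propositional.Properties using (allFin⁺)
open import Data.Maybe using (Maybe; just; nothing)
open import Data.Nat using (ℕ; zero; suc; _+_; _*_; _∸_; _^_; _≤_; _<_; z≤n; s≤s; z<s; _≤?_; _<?_; >-nonZero)
open import Data.Nat.ListAction using (product)
open import Data.Nat.Properties
open import Data.Nat.Tactic.RingSolver using (solve-∀)
open import Data.Product using (_×_; _,_; proj₁; proj₂)
open import Function using (_∘_)
open import Relation.Binary.Construct.Closure.ReflexiveTransitive using (Star; ε; _◅_; _◅◅_)
open import Relation.Binary.Core using (_Preserves_⟶_)
open import Relation.Binary.Definitions using (DecidableEquality)
open import Relation.Binary.PropositionalEquality hiding ([_])
open import Relation.Nullary using (Dec; yes; no; ¬_; contradiction)
open import Relation.Unary using (Decidable)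

-- Lists of consecutive numbers, and counting

range : ℕ → ℕ → List ℕ
range a zero    = []
range a (suc N) = a ∷ range (suc a) N

range-++ : ∀ a m n → range a (m + n) ≡ range a m ++ range (a + m) n
range-++ a zero    n = cong (λ b → range b n) (sym (+-identityʳ a))
range-++ a (suc m) n = cong (a ∷_) (trans (range-++ (suc a) m n)
                                          (cong (λ b → range (suc a) m ++ range b n) (sym (+-suc a m))))

map-suc-range : ∀ a N → map suc (range a N) ≡ range (suc a) N
map-suc-range a zero    = refl
map-suc-range a (suc N) = cong (suc a ∷_) (map-suc-range (suc a) N)

upTo≡range : ∀ N → upTo N ≡ range 0 N
upTo≡range zero    = refl
upTo≡range (suc N) = cong (0 ∷_) (begin
  applyUpTo suc N           ≡⟨ map-upTo suc N ⟨
  map suc (upTo N)        ≡⟨ cong (map suc) (upTo≡range N) ⟩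
  map suc (range 0 N)     ≡⟨ map-suc-range 0 N ⟩
  range 1 N               ∎)
  where open ≡-Reasoning

tabulate-toℕ : ∀ {A : Set} {m} (f : ℕ → A) → tabulate {n = m} (f ∘ toℕ) ≡ map f (range 0 m)
tabulate-toℕ {m = zero}  f = refl
tabulate-toℕ {m = suc m} f = cong (f 0 ∷_) (begin
  tabulate (f ∘ suc ∘ toℕ)       ≡⟨ tabulate-toℕ (f ∘ suc) ⟩
  map (f ∘ suc) (range 0 m)      ≡⟨ map-∘ (range 0 m) ⟩
  map f (map suc (range 0 m))    ≡⟨ cong (map f) (map-suc-range 0 m) ⟩
  map f (range 1 m)              ∎)
  where open ≡-Reasoning

range-bounded : ∀ a N → All (_< a + N) (range a N)
range-bounded a zero    = []
range-bounded a (suc N) =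
  m<m+n a z<s ∷ subst (λ b → All (_< b) (range (suc a) N)) (sym (+-suc a N)) (range-bounded (suc a) N)

length-range : ∀ a N → length (range a N) ≡ N
length-range a zero    = refl
length-range a (suc N) = cong suc (length-range (suc a) N)

concatMap-++-↭ : ∀ {A B : Set} (f g : A → List B) xs →
                 concatMap (λ x → f x ++ g x) xs ↭ concatMap f xs ++ concatMap g xs
concatMap-++-↭ f g []       = ↭-refl
concatMap-++-↭ f g (x ∷ xs) = ↭-trans (++⁺ˡ (f x ++ g x) (concatMap-++-↭ f g xs))
                                      (interchange (f x) (g x) (concatMap f xs) (concatMap g xs))
  where open Algebra.Properties.CommutativeSemigroup (CommutativeMonoid.commutativeSemigroup ++-commutativeMonoid)

range-blocks : ∀ a b M j₀ →
               concatMap (λ j → range (a + j * b) b) (range j₀ M) ≡ range (a + j₀ * b) (M * b)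
range-blocks a b zero    j₀ = refl
range-blocks a b (suc M) j₀ = begin
  range (a + j₀ * b) b ++ concatMap (λ j → range (a + j * b) b) (range (suc j₀) M)
    ≡⟨ cong (range (a + j₀ * b) b ++_) (range-blocks a b M (suc j₀)) ⟩
  range (a + j₀ * b) b ++ range (a + (b + j₀ * b)) (M * b)
    ≡⟨ cong (λ e → range (a + j₀ * b) b ++ range e (M * b)) a+[b+j₀b]≡a+j₀b+b ⟩
  range (a + j₀ * b) b ++ range (a + j₀ * b + b) (M * b)
    ≡⟨ range-++ (a + j₀ * b) b (M * b) ⟨
  range (a + j₀ * b) (b + M * b) ∎
  where
  open ≡-Reasoning
  a+[b+j₀b]≡a+j₀b+b : a + (b + j₀ * b) ≡ a + j₀ * b + b
  a+[b+j₀b]≡a+j₀b+b = trans (cong (a +_) (+-comm b (j₀ * b))) (sym (+-assoc a (j₀ * b) b))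

module _ {A : Set} {P : A → Set} (P? : Decidable P) where

  count : List A → ℕ
  count xs = length (filter P? xs)

  count-++ : ∀ xs ys → count (xs ++ ys) ≡ count xs + count ys
  count-++ xs ys = trans (cong length (filter-++ P? xs ys)) (length-++ (filter P? xs))

  count-↭ : ∀ {xs ys} → xs ↭ ys → count xs ≡ count ys
  count-↭ xs↭ys = ↭-length (filter-↭ P? xs↭ys)

  count-accept : ∀ {x} xs → P x → count (x ∷ xs) ≡ suc (count xs)
  count-accept xs px = cong length (filter-accept P? px)

  count-reject : ∀ {x} xs → ¬ P x → count (x ∷ xs) ≡ count xs
  count-reject xs ¬px = cong length (filter-reject P? ¬px)

  count-∷ : ∀ x xs → count xs ≤ count (x ∷ xs)
  count-∷ x xs = by-cases (P? x)
    where
    by-cases : Dec (P x) → count xs ≤ count (x ∷ xs)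
    by-cases (yes px) = ≤-trans (n≤1+n _) (≤-reflexive (sym (count-accept xs px)))
    by-cases (no ¬px) = ≤-reflexive (sym (count-reject xs ¬px))

  count-∈ : ∀ {x xs} → x ∈ xs → P x → 0 < count xs
  count-∈ x∈xs px = ∈-length (∈-filter⁺ P? x∈xs px)

  count-blocks : ∀ {B : Set} (pick : B → A) (block : B → List A) (w : ℕ) {bs : List B} →
                 All (λ b → P (pick b) → w ≤ count (block b)) bs →
                 w * count (map pick bs) ≤ count (concatMap block bs)
  count-blocks pick block w [] = ≤-reflexive (*-zeroʳ w)
  count-blocks pick block w {b ∷ bs} (wb ∷ wbs) = by-cases (P? (pick b))
    where
    open ≤-Reasoning
    by-cases : Dec (P (pick b)) → w * count (map pick (b ∷ bs)) ≤ count (concatMap block (b ∷ bs))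
    by-cases (yes pb) = begin
      w * count (pick b ∷ map pick bs)                ≡⟨ cong (w *_) (count-accept (map pick bs) pb) ⟩
      w * suc (count (map pick bs))                   ≡⟨ *-suc w _ ⟩
      w + w * count (map pick bs)                     ≤⟨ +-mono-≤ (wb pb) (count-blocks pick block w wbs) ⟩
      count (block b) + count (concatMap block bs)    ≡⟨ count-++ (block b) _ ⟨
      count (concatMap block (b ∷ bs))                ∎
    by-cases (no ¬pb) = begin
      w * count (pick b ∷ map pick bs)                ≡⟨ cong (w *_) (count-reject (map pick bs) ¬pb) ⟩
      w * count (map pick bs)                         ≤⟨ count-blocks pick block w wbs ⟩
      count (concatMap block bs)                      ≤⟨ m≤n+m _ _ ⟩
      count (block b) + count (concatMap block bs)    ≡⟨ count-++ (block b) _ ⟨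
      count (concatMap block (b ∷ bs))                ∎

count-≤-range : ∀ x a N → count (_≤? x) (range a N) ≤ suc x ∸ a
count-≤-range x a zero = z≤n
count-≤-range x a (suc N) with a ≤? x
... | yes a≤x = begin
  count (_≤? x) (a ∷ range (suc a) N)   ≡⟨ count-accept (_≤? x) (range (suc a) N) a≤x ⟩
  suc (count (_≤? x) (range (suc a) N)) ≤⟨ s≤s (count-≤-range x (suc a) N) ⟩
  suc (x ∸ a)                           ≡⟨ +-∸-assoc 1 a≤x ⟨
  suc x ∸ a                             ∎
  where open ≤-Reasoning
... | no a≰x = begin
  count (_≤? x) (a ∷ range (suc a) N)   ≡⟨ count-reject (_≤? x) (range (suc a) N) a≰x ⟩
  count (_≤? x) (range (suc a) N)       ≤⟨ count-≤-range x (suc a) N ⟩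
  x ∸ a                                 ≤⟨ ∸-monoˡ-≤ a (n≤1+n x) ⟩
  suc x ∸ a                             ∎
  where open ≤-Reasoning

count-≥-range : ∀ x a N → count (x ≤?_) (range a N) ≤ a + N ∸ x
count-≥-range x a N with x ≤? a
count-≥-range x a N | yes x≤a = begin
  count (x ≤?_) (range a N)             ≤⟨ length-filter (x ≤?_) (range a N) ⟩
  length (range a N)                    ≡⟨ length-range a N ⟩
  N                                     ≤⟨ m≤n+m N (a ∸ x) ⟩
  a ∸ x + N                             ≡⟨ +-∸-comm N x≤a ⟨
  a + N ∸ x                             ∎
  where open ≤-Reasoning
count-≥-range x a zero    | no x≰a = z≤n
count-≥-range x a (suc N) | no x≰a = begin
  count (x ≤?_) (a ∷ range (suc a) N)   ≡⟨ count-reject (x ≤?_) (range (suc a) N) x≰a ⟩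
  count (x ≤?_) (range (suc a) N)       ≤⟨ count-≥-range x (suc a) N ⟩
  suc a + N ∸ x                         ≡⟨ cong (_∸ x) (+-suc a N) ⟨
  a + suc N ∸ x                         ∎
  where open ≤-Reasoning

-- Firing

Increasing : ∀ {m} → (Fin m → ℕ) → Set
Increasing s = ∀ i j → i Fin.< j → s i < s j

module _ {k : ℕ} where

  Outside : Vertex k → Vertex k → Set
  Outside v w = ∀ x → w ≢ v ++ x

  descendant≢self : ∀ (v : Vertex k) {r} x → v ++ r ∷ x ≢ v
  descendant≢self v x eq with ++-identityʳ-unique v (sym eq)
  ... | ()

  outside-child : ∀ {v w} r → Outside v w → Outside (v ++ [ r ]) w
  outside-child {v} r out x eq = out (r ∷ x) (trans eq (++-assoc v [ r ] x))

  child-descendant≢self : ∀ (v : Vertex k) r x → (v ++ [ r ]) ++ x ≢ v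
  child-descendant≢self v r x eq = descendant≢self v x (trans (sym (++-assoc v [ r ] x)) eq)

  grandchild≢child : ∀ (v : Vertex k) r r' x r'' → (v ++ [ r ]) ++ r' ∷ x ≢ v ++ [ r'' ]
  grandchild≢child v r r' x r'' eq
    with ∷-injectiveʳ (++-cancelˡ v (r ∷ r' ∷ x) [ r'' ] (trans (sym (++-assoc v [ r ] (r' ∷ x))) eq))
  ... | ()

  parent-outside-child : ∀ v r → Outside (v ++ [ r ]) v
  parent-outside-child v r x eq = child-descendant≢self v r x (sym eq)

  sibling-outside : ∀ v {r r'} → r ≢ r' → ∀ x → Outside (v ++ [ r' ]) ((v ++ [ r ]) ++ x)
  sibling-outside v {r} {r'} r≢r' x y eq = r≢r' (∷-injectiveˡ (++-cancelˡ v _ _ (begin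
    v ++ r ∷ x         ≡⟨ ++-assoc v [ r ] x ⟨
    (v ++ [ r ]) ++ x  ≡⟨ eq ⟩
    (v ++ [ r' ]) ++ y ≡⟨ ++-assoc v [ r' ] y ⟩
    v ++ r' ∷ y        ∎)))
    where open ≡-Reasoning

  _≟ᵛ_ : DecidableEquality (Vertex k)
  _≟ᵛ_ = ≡-dec Fin._≟_

  childIndex : Vertex k → Vertex k → Maybe (Fin k)
  childIndex []      (r ∷ []) = just r
  childIndex (x ∷ v) (y ∷ w) with x Fin.≟ y
  ... | yes _ = childIndex v w
  ... | no  _ = nothing
  childIndex _       _        = nothing

  childIndex-child : ∀ v r → childIndex v (v ++ [ r ]) ≡ just r
  childIndex-child []      r = refl
  childIndex-child (x ∷ v) r with x Fin.≟ x
  ... | yes _   = childIndex-child v r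
  ... | no x≢x  = contradiction refl x≢x

  childIndex-sound : ∀ v w {r} → childIndex v w ≡ just r → w ≡ v ++ [ r ]
  childIndex-sound []      (r ∷ [])    refl = refl
  childIndex-sound []      (_ ∷ _ ∷ _) ()
  childIndex-sound (x ∷ v) []          ()
  childIndex-sound (x ∷ v) (y ∷ w) eq with x Fin.≟ y
  childIndex-sound (x ∷ v) (.x ∷ w) eq | yes refl = cong (x ∷_) (childIndex-sound v w eq)

  afterFiring : Config k → Vertex k → (Fin k → ℕ) → List ℕ → Config k
  afterFiring c v s rest w with w ≟ᵛ v | childIndex v w
  ... | yes _ | _       = rest
  ... | no _  | just r  = s r ∷ c w
  ... | no _  | nothing = c w

  afterFiring-self : ∀ c v s rest → afterFiring c v s rest v ≡ rest
  afterFiring-self c v s rest with v ≟ᵛ v | childIndex v v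
  ... | yes _   | _ = refl
  ... | no v≢v  | _ = contradiction refl v≢v

  afterFiring-child : ∀ c v s rest r → afterFiring c v s rest (v ++ [ r ]) ≡ s r ∷ c (v ++ [ r ])
  afterFiring-child c v s rest r with (v ++ [ r ]) ≟ᵛ v | childIndex v (v ++ [ r ]) | childIndex-child v r
  ... | yes eq | _ | _       = contradiction eq (descendant≢self v [])
  ... | no _   | _ | refl    = refl

  afterFiring-other : ∀ c v s rest w → w ≢ v → (∀ r → w ≢ v ++ [ r ]) → afterFiring c v s rest w ≡ c w
  afterFiring-other c v s rest w w≢v not-child with w ≟ᵛ v | childIndex v w in eq
  ... | yes w≡v | _       = contradiction w≡v w≢v
  ... | no _    | just r  = contradiction (childIndex-sound v w eq) (not-child r)
  ... | no _    | nothing = refl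

  fireAt : ∀ c v {s} rest → Increasing s → c v ↭ tabulate s ++ rest → Fire c (afterFiring c v s rest)
  fireAt c v {s} rest inc split = fire v s rest inc split (afterFiring-self c v s rest)
    (λ r → ↭-reflexive (afterFiring-child c v s rest r)) (afterFiring-other c v s rest)

  record Fired (c : Config k) (v : Vertex k) (Bs : List (Fin k → ℕ)) : Set where
    field
      config    : Config k
      moves     : Star Fire c config
      emptied   : config v ≡ []
      to-child  : ∀ r → config (v ++ [ r ]) ↭ map (λ s → s r) Bs ++ c (v ++ [ r ])
      elsewhere : ∀ w → w ≢ v → (∀ r → w ≢ v ++ [ r ]) → config w ≡ c w

  fireBatches : ∀ c v {Bs} → All Increasing Bs → c v ↭ concatMap tabulate Bs → Fired c v Bs
  fireBatches c v [] cv↭[] = record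
    { config = c ; moves = ε ; emptied = ↭-empty-inv cv↭[]
    ; to-child = λ r → ↭-refl ; elsewhere = λ w _ _ → refl }
  fireBatches c v {s ∷ Bs} (inc ∷ incs) split = record
    { config    = config
    ; moves     = fireAt c v rest inc split ◅ moves
    ; emptied   = emptied
    ; to-child  = λ r → ↭-trans (to-child r) (↭-trans
        (++⁺ˡ (map (λ s → s r) Bs) (↭-reflexive (afterFiring-child c v s rest r)))
        (shift (s r) (map (λ s → s r) Bs) _))
    ; elsewhere = λ w w≢v not-child →
        trans (elsewhere w w≢v not-child) (afterFiring-other c v s rest w w≢v not-child)
    }
    where
    rest : List ℕ
    rest = concatMap tabulate Bs
    open Fired (fireBatches (afterFiring c v s rest) v incs (↭-reflexive (afterFiring-self c v s rest)))

-- Lower and upper bounds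

module _ {k : ℕ} where

  root-not-child : ∀ (v : Vertex k) r → [] ≢ v ++ [ r ]
  root-not-child []      r ()
  root-not-child (_ ∷ _) r ()

  initial-child : ∀ n v r → initial k n (v ++ [ r ]) ≡ []
  initial-child n []      r = refl
  initial-child n (_ ∷ _) r = refl

  arrivals : Config k → (Vertex k → List (Fin k → ℕ)) → Vertex k → List ℕ
  arrivals c batches v = c v ++ concatMap tabulate (batches v)

  record History (n : ℕ) (c : Config k) : Set where
    field
      batches    : Vertex k → List (Fin k → ℕ)
      increasing : ∀ v → All Increasing (batches v)
      at-root    : arrivals c batches [] ↭ initial k n []
      at-child   : ∀ v r → arrivals c batches (v ++ [ r ]) ↭ map (λ s → s r) (batches v)

  history-initial : ∀ n → History n (initial k n)
  history-initial n = record
    { batches    = λ _ → []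
    ; increasing = λ _ → []
    ; at-root    = ↭-reflexive (++-identityʳ _)
    ; at-child   = λ v r → ↭-reflexive (trans (++-identityʳ _) (initial-child n v r))
    }

  history-fire : ∀ {n c c'} → History n c → Fire c c' → History n c'
  history-fire {n} {c} {c'} H (fire v s rest inc split left to-child frame) = record
    { batches    = batches'
    ; increasing = increasing'
    ; at-root    = ↭-trans (arrivals-not-child [] (root-not-child v)) at-root
    ; at-child   = at-child'
    }
    where
    open History H
    open PermutationReasoning

    batches' : Vertex k → List (Fin k → ℕ)
    batches' w with w ≟ᵛ v
    ... | yes _ = s ∷ batches w
    ... | no  _ = batches w

    batches'-self : batches' v ≡ s ∷ batches v
    batches'-self with v ≟ᵛ v
    ... | yes _   = refl
    ... | no v≢v  = contradiction refl v≢v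

    batches'-other : ∀ w → w ≢ v → batches' w ≡ batches w
    batches'-other w w≢v with w ≟ᵛ v
    ... | yes w≡v = contradiction w≡v w≢v
    ... | no  _   = refl

    increasing' : ∀ w → All Increasing (batches' w)
    increasing' w with w ≟ᵛ v
    ... | yes _ = inc ∷ increasing w
    ... | no  _ = increasing w

    arrivals-self : arrivals c' batches' v ↭ arrivals c batches v
    arrivals-self rewrite batches'-self | left = begin
      rest ++ tabulate s ++ concatMap tabulate (batches v)     ↭⟨ shifts rest (tabulate s) ⟩
      tabulate s ++ rest ++ concatMap tabulate (batches v)     ≡⟨ ++-assoc (tabulate s) rest _ ⟨
      (tabulate s ++ rest) ++ concatMap tabulate (batches v)   ↭⟨ ++⁺ʳ _ split ⟨
      arrivals c batches v                                     ∎

    arrivals-not-child : ∀ w → (∀ r → w ≢ v ++ [ r ]) → arrivals c' batches' w ↭ arrivals c batches w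
    arrivals-not-child w not-child = by-cases (w ≟ᵛ v)
      where
      by-cases : Dec (w ≡ v) → arrivals c' batches' w ↭ arrivals c batches w
      by-cases (yes refl) = arrivals-self
      by-cases (no w≢v) rewrite frame w w≢v not-child | batches'-other w w≢v = ↭-refl

    at-child' : ∀ p r → arrivals c' batches' (p ++ [ r ]) ↭ map (λ s → s r) (batches' p)
    at-child' p r = by-cases (p ≟ᵛ v)
      where
      by-cases : Dec (p ≡ v) → arrivals c' batches' (p ++ [ r ]) ↭ map (λ s → s r) (batches' p)
      by-cases (no p≢v) rewrite batches'-other p p≢v = ↭-trans
        (arrivals-not-child (p ++ [ r ]) (λ r' eq → p≢v (∷ʳ-injectiveˡ p v eq)))
        (at-child p r)
      by-cases (yes refl) rewrite batches'-self | batches'-other (p ++ [ r ]) (descendant≢self p []) = begin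
        c' (p ++ [ r ]) ++ concatMap tabulate (batches (p ++ [ r ]))  ↭⟨ ++⁺ʳ _ (to-child r) ⟩
        s r ∷ arrivals c batches (p ++ [ r ])                         ↭⟨ prep (s r) (at-child p r) ⟩
        s r ∷ map (λ s → s r) (batches p)                             ∎

  history-reachable : ∀ {n c} → Reachable k n c → History n c
  history-reachable = go (history-initial _)
    where
    go : ∀ {n c c'} → History n c → Star Fire c c' → History n c'
    go H ε          = H
    go H (f ◅ fs)   = go (history-fire H f) fs

increasing-tail : ∀ {m} {s : Fin (suc m) → ℕ} → Increasing s → Increasing (s ∘ Fin.suc)
increasing-tail inc i j i<j = inc (Fin.suc i) (Fin.suc j) (s≤s i<j)

increasing-count-≤ : ∀ {m} {s : Fin m → ℕ} {x} → Increasing s → ∀ r → s r ≤ x →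
                     suc (toℕ r) ≤ count (_≤? x) (tabulate s)
increasing-count-≤ {s = s} {x} inc Fin.zero s0≤x =
  ≤-trans (s≤s z≤n) (≤-reflexive (sym (count-accept (_≤? x) (tabulate (s ∘ Fin.suc)) s0≤x)))
increasing-count-≤ {s = s} {x} inc (Fin.suc r) sr≤x = begin
  suc (suc (toℕ r))                              ≤⟨ s≤s (increasing-count-≤ (increasing-tail inc) r sr≤x) ⟩
  suc (count (_≤? x) (tabulate (s ∘ Fin.suc)))   ≡⟨ count-accept (_≤? x) _ s0≤x ⟨
  count (_≤? x) (tabulate s)                     ∎
  where
  open ≤-Reasoning
  s0≤x : s Fin.zero ≤ x
  s0≤x = ≤-trans (<⇒≤ (inc Fin.zero (Fin.suc r) z<s)) sr≤x

increasing-count-≥ : ∀ {m} {s : Fin m → ℕ} {x} → Increasing s → ∀ r → x ≤ s r →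
                     m ∸ toℕ r ≤ count (x ≤?_) (tabulate s)
increasing-count-≥ {m} {s} {x} inc Fin.zero x≤s0 = ≤-reflexive (begin
  m                                    ≡⟨ length-tabulate s ⟨
  length (tabulate s)                  ≡⟨ cong length (filter-all (x ≤?_) (tabulate⁺ x≤s)) ⟨
  count (x ≤?_) (tabulate s)           ∎)
  where
  open ≡-Reasoning
  x≤s : ∀ i → x ≤ s i
  x≤s Fin.zero    = x≤s0
  x≤s (Fin.suc i) = ≤-trans x≤s0 (<⇒≤ (inc Fin.zero (Fin.suc i) z<s))
increasing-count-≥ {suc m} {s} {x} inc (Fin.suc r) x≤sr = begin
  m ∸ toℕ r                                  ≤⟨ increasing-count-≥ (increasing-tail inc) r x≤sr ⟩
  count (x ≤?_) (tabulate (s ∘ Fin.suc))     ≤⟨ count-∷ (x ≤?_) (s Fin.zero) _ ⟩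
  count (x ≤?_) (tabulate s)                 ∎
  where open ≤-Reasoning

product-positive : ∀ {A : Set} (w : A → ℕ) → (∀ a → 0 < w a) → ∀ t → 0 < product (map w t)
product-positive w w>0 []      = z<s
product-positive w w>0 (a ∷ t) = *-mono-≤ (w>0 a) (product-positive w w>0 t)

product-descent : ∀ {A : Set} (w : A → ℕ) (G : List A → ℕ) → (∀ p r → w r * G (p ++ [ r ]) ≤ G p) →
                  ∀ p u → product (map w u) * G (p ++ u) ≤ G p
product-descent w G descent p [] = ≤-reflexive (trans (+-identityʳ _) (cong G (++-identityʳ p)))
product-descent w G descent p (r ∷ u) = begin
  (w r * W) * G (p ++ r ∷ u)          ≡⟨ *-assoc (w r) W _ ⟩
  w r * (W * G (p ++ r ∷ u))          ≡⟨ cong (λ v → w r * (W * G v)) (++-assoc p [ r ] u) ⟨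
  w r * (W * G ((p ++ [ r ]) ++ u))   ≤⟨ *-monoʳ-≤ (w r) (product-descent w G descent (p ++ [ r ]) u) ⟩
  w r * G (p ++ [ r ])                ≤⟨ descent p r ⟩
  G p                                 ∎
  where
  open ≤-Reasoning
  W : ℕ
  W = product (map w u)

module _ {k n : ℕ} {c : Config k} (reach : Reachable k n c)
         {Q : ℕ → Set} (Q? : Decidable Q) (w : Fin k → ℕ)
         (batch-count : ∀ {s} → Increasing s → ∀ r → Q (s r) → w r ≤ count Q? (tabulate s)) where

  product-≤-count-initial : ∀ t {x} → x ∈ c t → Q x → product (map w t) ≤ count Q? (initial k n [])
  product-≤-count-initial t {x} x∈ct qx = begin
    product (map w t)               ≡⟨ *-identityʳ _ ⟨
    product (map w t) * 1           ≤⟨ *-monoʳ-≤ (product (map w t)) (count-∈ Q? (∈-++⁺ˡ x∈ct) qx) ⟩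
    product (map w t) * G t         ≤⟨ product-descent w G descent [] t ⟩
    G []                            ≡⟨ count-↭ Q? at-root ⟩
    count Q? (initial k n [])       ∎
    where
    open ≤-Reasoning
    open History (history-reachable reach)
    G : Vertex k → ℕ
    G v = count Q? (arrivals c batches v)
    descent : ∀ p r → w r * G (p ++ [ r ]) ≤ G p
    descent p r = begin
      w r * G (p ++ [ r ])                             ≡⟨ cong (w r *_) (count-↭ Q? (at-child p r)) ⟩
      w r * count Q? (map (λ s → s r) (batches p))    ≤⟨ count-blocks Q? (λ s → s r) tabulate (w r)
                                                           (All.map (λ inc → batch-count inc r) (increasing p)) ⟩
      count Q? (concatMap tabulate (batches p))        ≤⟨ m≤n+m _ _ ⟩
      count Q? (c p) + count Q? (concatMap tabulate (batches p)) ≡⟨ count-++ Q? (c p) _ ⟨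
      G p                                              ∎

initial-root : ∀ k n → initial k n [] ≡ map suc (range 0 (k ^ n))
initial-root k n = cong (map suc) (upTo≡range (k ^ n))

initial-root-range : ∀ k n → initial k n [] ≡ range 1 (k ^ n)
initial-root-range k n = trans (initial-root k n) (map-suc-range 0 (k ^ n))

minChip-≤ : ∀ {k n c} → Reachable k n c → ∀ t {x} → x ∈ c t → minChip k t ≤ x
minChip-≤ {k} {n} reach t {x} x∈ct = begin
  minChip k t                          ≤⟨ product-≤-count-initial reach (_≤? x) (suc ∘ toℕ)
                                            increasing-count-≤ t x∈ct ≤-refl ⟩
  count (_≤? x) (initial k n [])       ≡⟨ cong (count (_≤? x)) (initial-root-range k n) ⟩
  count (_≤? x) (range 1 (k ^ n))      ≤⟨ count-≤-range x 1 (k ^ n) ⟩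
  x                                    ∎
  where open ≤-Reasoning

0<m≤o∸n⇒n≤o∸m : ∀ {m n o} → 0 < m → m ≤ o ∸ n → n ≤ o ∸ m
0<m≤o∸n⇒n≤o∸m {m} {n} {o} 0<m m≤o∸n = m+n≤o⇒m≤o∸n n (begin
  n + m       ≡⟨ +-comm n m ⟩
  m + n       ≤⟨ m≤o∸n⇒m+n≤o m n≤o m≤o∸n ⟩
  o           ∎)
  where
  open ≤-Reasoning
  n≤o : n ≤ o
  n≤o = <⇒≤ (m∸n≢0⇒n<m (>⇒≢ (<-≤-trans 0<m m≤o∸n)))

≤-maxChip : ∀ {k n c} → Reachable k n c → ∀ t {x} → x ∈ c t → x ≤ maxChip k n t
≤-maxChip {k} {n} reach t {x} x∈ct =
  subst (λ M → x ≤ M ∸ P) (+-comm 1 (k ^ n)) (0<m≤o∸n⇒n≤o∸m P>0 (begin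
    P                                  ≤⟨ product-≤-count-initial reach (x ≤?_) (λ i → k ∸ toℕ i)
                                            increasing-count-≥ t x∈ct ≤-refl ⟩
    count (x ≤?_) (initial k n [])     ≡⟨ cong (count (x ≤?_)) (initial-root-range k n) ⟩
    count (x ≤?_) (range 1 (k ^ n))    ≤⟨ count-≥-range x 1 (k ^ n) ⟩
    1 + k ^ n ∸ x                      ∎))
  where
  open ≤-Reasoning
  P : ℕ
  P = product (map (λ i → k ∸ toℕ i) t)
  P>0 : 0 < P
  P>0 = product-positive (λ i → k ∸ toℕ i) (λ i → m<n⇒0<n∸m (toℕ<n i)) t

-- Strategies attaining the bounds

-- Rank of the chip in slot r of batch j, when N batches of size k are formed from the ranks
-- 0, …, kN − 1 and the first p slots of all batches take the Np lowest ranks.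
module Slots (k p N : ℕ) where

  q : ℕ
  q = k ∸ p

  slot : ℕ → ℕ → ℕ
  slot j r with r <? p
  ... | yes _ = j * p + r
  ... | no  _ = N * p + j * q + (r ∸ p)

  slot-low : ∀ j {r} → r < p → slot j r ≡ j * p + r
  slot-low j {r} r<p with r <? p
  ... | yes _   = refl
  ... | no r≮p  = contradiction r<p r≮p

  slot-high : ∀ j {r} → p ≤ r → slot j r ≡ N * p + j * q + (r ∸ p)
  slot-high j {r} p≤r with r <? p
  ... | yes r<p = contradiction p≤r (<⇒≱ r<p)
  ... | no  _   = refl

  slot-monoʳ : ∀ {j r r'} → j < N → r < r' → slot j r < slot j r'
  slot-monoʳ {j} {r} {r'} j<N r<r' = by-cases (r <? p) (r' <? p)
    where
    open ≤-Reasoning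
    by-cases : Dec (r < p) → Dec (r' < p) → slot j r < slot j r'
    by-cases (yes r<p) (yes r'<p) rewrite slot-low j r<p | slot-low j r'<p = +-monoʳ-< (j * p) r<r'
    by-cases (yes r<p) (no r'≮p) rewrite slot-low j r<p | slot-high j (≮⇒≥ r'≮p) = begin-strict
      j * p + r                             <⟨ +-monoʳ-< (j * p) r<p ⟩
      j * p + p                             ≡⟨ +-comm (j * p) p ⟩
      suc j * p                             ≤⟨ *-monoˡ-≤ p j<N ⟩
      N * p                                 ≤⟨ m≤m+n (N * p) _ ⟩
      N * p + j * q                         ≤⟨ m≤m+n _ _ ⟩
      N * p + j * q + (r' ∸ p)              ∎
    by-cases (no r≮p) (yes r'<p) = contradiction (<-trans r<r' r'<p) r≮p
    by-cases (no r≮p) (no r'≮p) rewrite slot-high j (≮⇒≥ r≮p) | slot-high j (≮⇒≥ r'≮p) =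
      +-monoʳ-< (N * p + j * q) (∸-monoˡ-< r<r' (≮⇒≥ r≮p))

  slot-monoˡ : ∀ {r j j'} → r < k → j < j' → slot j r < slot j' r
  slot-monoˡ {r} {j} {j'} r<k j<j' = by-cases (r <? p)
    where
    by-cases : Dec (r < p) → slot j r < slot j' r
    by-cases (yes r<p) rewrite slot-low j r<p | slot-low j' r<p =
      +-monoˡ-< r (*-monoˡ-< p {{>-nonZero (≤-<-trans z≤n r<p)}} j<j')
    by-cases (no r≮p) rewrite slot-high j (≮⇒≥ r≮p) | slot-high j' (≮⇒≥ r≮p) =
      +-monoˡ-< (r ∸ p) (+-monoʳ-< (N * p) (*-monoˡ-< q {{>-nonZero 0<q}} j<j'))
      where
      0<q : 0 < q
      0<q = m<n⇒0<n∸m (≤-<-trans (≮⇒≥ r≮p) r<k)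

  map-slot-low : ∀ j a m → a + m ≤ p → map (slot j) (range a m) ≡ range (j * p + a) m
  map-slot-low j a zero    _      = refl
  map-slot-low j a (suc m) a+m<p = cong₂ _∷_
    (slot-low j (≤-trans (s≤s (m≤m+n a m)) a+1+m≤p))
    (trans (map-slot-low j (suc a) m a+1+m≤p) (cong (λ b → range b m) (+-suc (j * p) a)))
    where
    a+1+m≤p : suc a + m ≤ p
    a+1+m≤p = subst (_≤ p) (+-suc a m) a+m<p

  map-slot-high : ∀ j a m → p ≤ a → map (slot j) (range a m) ≡ range (N * p + j * q + (a ∸ p)) m
  map-slot-high j a zero    _   = refl
  map-slot-high j a (suc m) p≤a = cong₂ _∷_ (slot-high j p≤a)
    (trans (map-slot-high j (suc a) m (m≤n⇒m≤1+n p≤a))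
           (cong (λ b → range b m) (trans (cong (N * p + j * q +_) (+-∸-assoc 1 p≤a)) (+-suc _ _))))

  slot-row : ∀ j → p ≤ k → map (slot j) (range 0 k) ≡ range (j * p) p ++ range (N * p + j * q) q
  slot-row j p≤k = begin
    map (slot j) (range 0 k)                                  ≡⟨ cong (map (slot j) ∘ range 0) (m+[n∸m]≡n p≤k) ⟨
    map (slot j) (range 0 (p + q))                            ≡⟨ cong (map (slot j)) (range-++ 0 p q) ⟩
    map (slot j) (range 0 p ++ range p q)                     ≡⟨ map-++ (slot j) (range 0 p) _ ⟩
    map (slot j) (range 0 p) ++ map (slot j) (range p q)
      ≡⟨ cong₂ _++_ (map-slot-low j 0 p ≤-refl) (map-slot-high j p q ≤-refl) ⟩
    range (j * p + 0) p ++ range (N * p + j * q + (p ∸ p)) q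
      ≡⟨ cong₂ (λ a b → range a p ++ range (N * p + j * q + b) q) (+-identityʳ _) (n∸n≡0 p) ⟩
    range (j * p) p ++ range (N * p + j * q + 0) q
      ≡⟨ cong (λ b → range (j * p) p ++ range b q) (+-identityʳ _) ⟩
    range (j * p) p ++ range (N * p + j * q) q                ∎
    where open ≡-Reasoning

  slots-↭ : p ≤ k → concatMap (λ j → map (slot j) (range 0 k)) (range 0 N) ↭ range 0 (k * N)
  slots-↭ p≤k = begin
    concatMap (λ j → map (slot j) (range 0 k)) (range 0 N)
      ≡⟨ concatMap-cong (λ j → slot-row j p≤k) (range 0 N) ⟩
    concatMap (λ j → range (j * p) p ++ range (N * p + j * q) q) (range 0 N)
      ↭⟨ concatMap-++-↭ (λ j → range (j * p) p) (λ j → range (N * p + j * q) q) (range 0 N) ⟩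
    concatMap (λ j → range (j * p) p) (range 0 N) ++ concatMap (λ j → range (N * p + j * q) q) (range 0 N)
      ≡⟨ cong₂ _++_ (range-blocks 0 p N 0) (range-blocks (N * p) q N 0) ⟩
    range 0 (N * p) ++ range (N * p + 0) (N * q)
      ≡⟨ cong (λ b → range 0 (N * p) ++ range b (N * q)) (+-identityʳ (N * p)) ⟩
    range 0 (N * p) ++ range (N * p) (N * q)
      ≡⟨ range-++ 0 (N * p) (N * q) ⟨
    range 0 (N * p + N * q)
      ≡⟨ cong (range 0) (*-distribˡ-+ N p q) ⟨
    range 0 (N * (p + q))
      ≡⟨ cong (λ m → range 0 (N * m)) (m+[n∸m]≡n p≤k) ⟩
    range 0 (N * k)
      ≡⟨ cong (range 0) (*-comm N k) ⟩
    range 0 (k * N) ∎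
    where open PermutationReasoning

module _ {k : ℕ} where

  record Fresh (c : Config k) (u : Vertex k) (g : ℕ → ℕ) (N : ℕ) : Set where
    field
      increasing  : g Preserves _<_ ⟶ _<_
      contents    : c u ↭ map g (range 0 N)
      empty-below : ∀ r x → c (u ++ r ∷ x) ≡ []

  record Solved (c : Config k) (u t : Vertex k) (chip : ℕ) : Set where
    field
      final        : Config k
      moves        : Star Fire c final
      frame        : ∀ w → Outside u w → final w ≡ c w
      stable-below : ∀ x → length (final (u ++ x)) < k
      target       : chip ∈ final (u ++ t)

  fresh-frame : ∀ {c c' u u' g N} → (∀ w → Outside u' w → c' w ≡ c w) → (∀ x → Outside u' (u ++ x)) →
                Fresh c u g N → Fresh c' u g N
  fresh-frame {u = u} {u'} frame outside fresh = record
    { increasing  = increasing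
    ; contents    = ↭-trans (↭-reflexive (frame u (subst (Outside u') (++-identityʳ u) (outside [])))) contents
    ; empty-below = λ r x → trans (frame _ (outside (r ∷ x))) (empty-below r x)
    }
    where open Fresh fresh

  module Siblings {N ρ : ℕ} {t : Vertex k}
                  (solve-subtree : ∀ {d u h} → Fresh d u h N → Solved d u t (h ρ))
                  (v : Vertex k) (gs : Fin k → ℕ → ℕ) where

    ChildSolved : Config k → Fin k → Set
    ChildSolved d r = (∀ x → length (d ((v ++ [ r ]) ++ x)) < k) × gs r ρ ∈ d ((v ++ [ r ]) ++ t)

    record SiblingsSolved (L : List (Fin k)) (d : Config k) : Set where
      field
        final  : Config k
        moves  : Star Fire d final
        frame  : ∀ w → All (λ r → Outside (v ++ [ r ]) w) L → final w ≡ d w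
        solved : All (ChildSolved final) L

    solve-siblings : ∀ {L d} → Unique L → All (λ r → Fresh d (v ++ [ r ]) (gs r) N) L → SiblingsSolved L d
    solve-siblings {d = d} [] [] = record { final = d ; moves = ε ; frame = λ _ _ → refl ; solved = [] }
    solve-siblings {r ∷ L} (r∉L ∷ unique) (fresh ∷ fresh-rest) = record
      { final  = final
      ; moves  = S.moves ◅◅ moves
      ; frame  = λ { w (out ∷ outs) → trans (frame w outs) (S.frame w out) }
      ; solved = (stable-r , target-r) ∷ solved
      }
      where
      module S = Solved (solve-subtree fresh)
      still-fresh : All (λ r' → Fresh S.final (v ++ [ r' ]) (gs r') N) L
      still-fresh = All.zipWith (λ (r≢r' , fresh') → fresh-frame S.frame (sibling-outside v (≢-sym r≢r')) fresh')
                                (r∉L , fresh-rest)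
      open SiblingsSolved (solve-siblings unique still-fresh)
      untouched : ∀ x → final ((v ++ [ r ]) ++ x) ≡ S.final ((v ++ [ r ]) ++ x)
      untouched x = frame _ (All.map (λ r≢r' → sibling-outside v r≢r' x) r∉L)
      stable-r : ∀ x → length (final ((v ++ [ r ]) ++ x)) < k
      stable-r x = subst (λ l → length l < k) (sym (untouched x)) (S.stable-below x)
      target-r : gs r ρ ∈ final ((v ++ [ r ]) ++ t)
      target-r = subst (gs r ρ ∈_) (sym (untouched t)) S.target

module Strategy {k : ℕ} (1<k : 1 < k) (split : Fin k → ℕ) (split≤k : ∀ a → split a ≤ k) where

  -- The rank, among the chips initially at the root of a subtree, of the chip that the strategy
  -- sends along t.
  position : List (Fin k) → ℕ
  position []      = 0
  position (a ∷ t) = Slots.slot k (split a) (k ^ length t) (position t) (toℕ a)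

  solve-leaf : ∀ {c v g} → Fresh c v g 1 → Solved c v [] (g 0)
  solve-leaf {c} {v} {g} fresh = record
    { final = c ; moves = ε ; frame = λ _ _ → refl ; stable-below = stable ; target = target }
    where
    open Fresh fresh
    cv≡[g0] : c (v ++ []) ≡ [ g 0 ]
    cv≡[g0] = trans (cong c (++-identityʳ v)) (↭-singleton-inv contents)
    stable : ∀ x → length (c (v ++ x)) < k
    stable []      = subst (λ l → length l < k) (sym cv≡[g0]) 1<k
    stable (r ∷ x) = subst (λ l → length l < k) (sym (empty-below r x)) (<-trans z<s 1<k)
    target : g 0 ∈ c (v ++ [])
    target = subst (g 0 ∈_) (sym cv≡[g0]) (here refl)

  module Node (a : Fin k) (t : List (Fin k))
              (solve-subtree : ∀ {d u h} → Fresh d u h (k ^ length t) → Solved d u t (h (position t)))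
              {c : Config k} {v : Vertex k} {g : ℕ → ℕ} (fresh : Fresh c v g (k * k ^ length t)) where

    open Fresh fresh
    N : ℕ
    N = k ^ length t
    open Slots k (split a) N

    child-chips : Fin k → ℕ → ℕ
    child-chips r j = g (slot j (toℕ r))

    batch : ℕ → Fin k → ℕ
    batch j r = child-chips r j

    batches : List (Fin k → ℕ)
    batches = map batch (range 0 N)

    batches-increasing : All Increasing batches
    batches-increasing = gmap⁺ (λ j<N i i' i<i' → increasing (slot-monoʳ j<N i<i')) (range-bounded 0 N)

    rows : List (List ℕ)
    rows = map (λ j → map (slot j) (range 0 k)) (range 0 N)

    batches-flatten : concatMap tabulate batches ≡ map g (concat rows)
    batches-flatten = begin
      concat (map tabulate (map batch (range 0 N)))                  ≡⟨ cong concat (map-∘ (range 0 N)) ⟨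
      concat (map (tabulate ∘ batch) (range 0 N))                    ≡⟨ concatMap-cong row (range 0 N) ⟩
      concat (map (λ j → map g (map (slot j) (range 0 k))) (range 0 N)) ≡⟨ cong concat (map-∘ (range 0 N)) ⟩
      concat (map (map g) rows)                                      ≡⟨ concat-map rows ⟩
      map g (concat rows)                                            ∎
      where
      open ≡-Reasoning
      row : ∀ j → tabulate (batch j) ≡ map g (map (slot j) (range 0 k))
      row j = trans (tabulate-toℕ (g ∘ slot j)) (map-∘ (range 0 k))

    contents-batched : c v ↭ concatMap tabulate batches
    contents-batched = begin
      c v                           ↭⟨ contents ⟩
      map g (range 0 (k * N))       ↭⟨ map⁺ g (slots-↭ (split≤k a)) ⟨
      map g (concat rows)           ≡⟨ batches-flatten ⟨
      concatMap tabulate batches    ∎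
      where open PermutationReasoning

    open Fired (fireBatches c v batches-increasing contents-batched)

    child-receives : ∀ r → config (v ++ [ r ]) ↭ map (child-chips r) (range 0 N)
    child-receives r = ↭-trans (to-child r) (↭-reflexive (begin
      map (λ s → s r) batches ++ c (v ++ [ r ])   ≡⟨ cong (map (λ s → s r) batches ++_) (empty-below r []) ⟩
      map (λ s → s r) batches ++ []               ≡⟨ ++-identityʳ _ ⟩
      map (λ s → s r) (map batch (range 0 N))     ≡⟨ map-∘ (range 0 N) ⟨
      map (child-chips r) (range 0 N)             ∎))
      where open ≡-Reasoning

    child-fresh : ∀ r → Fresh config (v ++ [ r ]) (child-chips r) N
    child-fresh r = record
      { increasing  = λ j<j' → increasing (slot-monoˡ (toℕ<n r) j<j')
      ; contents    = child-receives r
      ; empty-below = λ r' x → trans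
          (elsewhere _ (child-descendant≢self v r (r' ∷ x)) (grandchild≢child v r r' x))
          (trans (cong c (++-assoc v [ r ] (r' ∷ x))) (empty-below r (r' ∷ x)))
      }

    open Siblings solve-subtree v child-chips

    siblings : SiblingsSolved (allFin k) config
    siblings = solve-siblings (allFin⁺ k) (All.tabulate (λ {r} _ → child-fresh r))

    solved : Solved c v (a ∷ t) (g (position (a ∷ t)))
    solved = record
      { final        = S.final
      ; moves        = moves ◅◅ S.moves
      ; frame        = λ w out → trans
          (S.frame w (All.tabulate (λ {r} _ → outside-child r out)))
          (elsewhere w (λ eq → out [] (trans eq (sym (++-identityʳ v)))) (λ r → out [ r ]))
      ; stable-below = stable
      ; target       = subst (_ ∈_) (cong S.final (++-assoc v [ a ] t)) (proj₂ (solved-child a))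
      }
      where
      module S = SiblingsSolved siblings
      solved-child : ∀ r → ChildSolved S.final r
      solved-child r = All.lookup S.solved (∈-allFin r)
      final-v : S.final (v ++ []) ≡ []
      final-v = trans (cong S.final (++-identityʳ v))
                      (trans (S.frame v (All.tabulate (λ {r} _ → parent-outside-child v r))) emptied)
      stable : ∀ x → length (S.final (v ++ x)) < k
      stable []      = subst (λ l → length l < k) (sym final-v) (<-trans z<s 1<k)
      stable (r ∷ x) = subst (λ w → length (S.final w) < k) (++-assoc v [ r ] x) (proj₁ (solved-child r) x)

  solve : ∀ t {c v g} → Fresh c v g (k ^ length t) → Solved c v t (g (position t))
  solve []      = solve-leaf
  solve (a ∷ t) = Node.solved a t (solve t)

  canBeOn-position : ∀ t → CanBeOn k (length t) t (suc (position t))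
  canBeOn-position t = final , moves , stable-below , target
    where
    root-fresh : Fresh (initial k (length t)) [] suc (k ^ length t)
    root-fresh = record
      { increasing = s≤s ; contents = ↭-reflexive (initial-root k (length t)) ; empty-below = λ _ _ → refl }
    open Solved (solve t root-fresh)

module _ {k : ℕ} (1<k : 1 < k) where

  module Lowest  = Strategy 1<k (λ a → suc (toℕ a)) toℕ<n
  module Highest = Strategy 1<k toℕ (λ a → <⇒≤ (toℕ<n a))

  lowest-chip : ∀ t → suc (Lowest.position t) ≡ minChip k t
  lowest-chip []      = refl
  lowest-chip (a ∷ t) = begin
    suc (Lowest.position (a ∷ t))                 ≡⟨ cong suc (Slots.slot-low k (suc A) (k ^ length t) ρ ≤-refl) ⟩
    suc (ρ * suc A + A)                           ≡⟨ rearrange ρ A ⟩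
    suc A * suc ρ                                 ≡⟨ cong (suc A *_) (lowest-chip t) ⟩
    suc A * minChip k t                           ∎
    where
    open ≡-Reasoning
    A : ℕ
    A = toℕ a
    ρ : ℕ
    ρ = Lowest.position t
    rearrange : ∀ ρ A → suc (ρ * suc A + A) ≡ suc A * suc ρ
    rearrange = solve-∀

  highest-position : ∀ t → Highest.position t + product (map (λ i → k ∸ toℕ i) t) ≡ k ^ length t
  highest-position []      = refl
  highest-position (a ∷ t) = begin
    Highest.position (a ∷ t) + B * Q        ≡⟨ cong (_+ B * Q) (Slots.slot-high k A N ρ ≤-refl) ⟩
    N * A + ρ * B + (A ∸ A) + B * Q         ≡⟨ cong (λ z → N * A + ρ * B + z + B * Q) (n∸n≡0 A) ⟩
    N * A + ρ * B + 0 + B * Q               ≡⟨ collect N A ρ B Q ⟩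
    N * A + B * (ρ + Q)                     ≡⟨ cong (λ z → N * A + B * z) (highest-position t) ⟩
    N * A + B * N                           ≡⟨ factor N A B ⟩
    (A + B) * N                             ≡⟨ cong (_* N) (m+[n∸m]≡n (<⇒≤ (toℕ<n a))) ⟩
    k * N                                   ∎
    where
    open ≡-Reasoning
    A : ℕ
    A = toℕ a
    B : ℕ
    B = k ∸ A
    N : ℕ
    N = k ^ length t
    ρ : ℕ
    ρ = Highest.position t
    Q : ℕ
    Q = product (map (λ i → k ∸ toℕ i) t)
    collect : ∀ N A ρ B Q → N * A + ρ * B + 0 + B * Q ≡ N * A + B * (ρ + Q)
    collect = solve-∀
    factor : ∀ N A B → N * A + B * N ≡ (A + B) * N
    factor = solve-∀

  highest-chip : ∀ t → suc (Highest.position t) ≡ maxChip k (length t) t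
  highest-chip t = begin
    suc ρ                       ≡⟨ m+n∸n≡m (suc ρ) Q ⟨
    suc ρ + Q ∸ Q               ≡⟨ cong (_∸ Q) (+-comm 1 (ρ + Q)) ⟩
    ρ + Q + 1 ∸ Q               ≡⟨ cong (λ z → z + 1 ∸ Q) (highest-position t) ⟩
    k ^ length t + 1 ∸ Q        ∎
    where
    open ≡-Reasoning
    ρ : ℕ
    ρ = Highest.position t
    Q : ℕ
    Q = product (map (λ i → k ∸ toℕ i) t)

corollary5p3 : (k n : ℕ) → 2 ≤ k → 1 ≤ n → (t : List (Fin k)) → length t ≡ n →
    IsMinimum (CanBeOn k n t) (minChip k t) × IsMaximum (CanBeOn k n t) (maxChip k n t)
corollary5p3 k .(length t) 1<k _ t refl =
  ( subst (CanBeOn k (length t) t) (lowest-chip 1<k t) (Lowest.canBeOn-position 1<k t)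
  , λ x (_ , reach , _ , x∈ct) → minChip-≤ reach t x∈ct )
  ,
  ( subst (CanBeOn k (length t) t) (highest-chip 1<k t) (Highest.canBeOn-position 1<k t)
  , λ x (_ , reach , _ , x∈ct) → ≤-maxChip reach t x∈ct )
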